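{- Let $n \geq 2$, let $v, w$ be two distinct vertices of $LTQ_n$, let $d = \lambda(w, v)$, and let $k$ be an integer with $1 \leq k \leq d$. Then $$|\mathcal{F}(v, w; k, d)| = 2^{d-k}.$$
   Context: The $n$-dimensional locally twisted cube $LTQ_n$ ($n \geq 2$) is the graph defined recursively as follows. Its vertices are the binary strings $x_1x_2\cdots x_n$ of length $n$. $LTQ_2$ is the 4-cycle $Q_2$ on $\{00,01,10,11\}$ (two strings adjacent iff they differ in exactly one bit). For $n \geq 3$, $LTQ_n$ is obtained from two disjoint copies of $LTQ_{n-1}$: one copy obtained by prefixing every vertex label with $0$, the other by prefixing every vertex label with $1$ (edges inside each copy are kept), and additionally each vertex $0x_2x_3\cdots x_n$ is joined to the vertex $1(x_2+x_n)x_3\cdots x_n$, where $+$ denotes addition modulo 2. For distinct vertices $x = x_1\cdots x_n$, $y = y_1\cdots y_n$, let $\lambda(x,y)$ be the smallest index $i$ with $x_i \neq y_i$. For every vertex $u$ and every $i \in \{1,\dots,n\}$ there is exactly one neighbour $u'$ of $u$ in $LTQ_n$ with $\lambda(u,u') = i$. For a vertex $v$, define $\tau_v : V(LTQ_n)\setminus\{v\} \to V(LTQ_n)$ by letting $\tau_v(u)$ be the unique neighbour $u'$ of $u$ with $\lambda(u,u') = \lambda(u,v)$; then either $\tau_v(u) = v$ or $\lambda(\tau_v(u), v) > \lambda(u,v)$. For $u \neq v$, let $\mathcal{P}_{u,v} = (u_0, u_1, \dots, u_\ell)$ be the path with $u_0 = u$, $u_{i+1} = \tau_v(u_i)$ for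 $0 \le i < \ell$, and $u_\ell = v$ (the first time $v$ is reached). For integers $1 \le t_1 \le t_2 \le n$ let $D_v(t_1,t_2) = \{u \in V(LTQ_n)\setminus\{v\} : t_1 \le \lambda(u,v) \le t_2\}$, and let $\mathcal{F}(v,w;t_1,t_2) = \{u \in D_v(t_1,t_2) : w \text{ is a vertex of } \mathcal{P}_{u,v}\}$. -}

module Defs where

open import Data.Bool using (Bool; true; false; _xor_; if_then_else_)
open import Data.Bool.Properties using (_≟_)
open import Data.Nat using (ℕ; zero; suc; _≤_)
open import Data.Vec using (Vec; []; _∷_; head; tail; last)
open import Data.Product using (_×_)
open import Relation.Binary.PropositionalEquality using (_≡_; _≢_)
open import Relation.Nullary using (does)

-- Vertices of LTQ_n: binary strings x₁x₂⋯xₙ, represented as Vec Bool n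
-- (head = x₁, false = 0, true = 1).

hamming : ∀ {n} → Vec Bool n → Vec Bool n → ℕ
hamming [] [] = 0
hamming (a ∷ x) (b ∷ y) = if does (a ≟ b) then hamming x y else suc (hamming x y)

twist : ∀ {m} → Vec Bool (suc (suc m)) → Vec Bool (suc (suc m))
twist x = (head x xor last x) ∷ tail x

-- Adjacency in LTQ_n, defined recursively exactly as in the paper
-- (only for n ≥ 2; undirected, so both orientations of cross edges).
data Adj : (n : ℕ) → Vec Bool n → Vec Bool n → Set where
  base   : ∀ {x y : Vec Bool 2} → hamming x y ≡ 1 → Adj 2 x y
  inner  : ∀ {m} {x y : Vec Bool (suc (suc m))} (b : Bool) →
           Adj (suc (suc m)) x y → Adj (suc (suc (suc m))) (b ∷ x) (b ∷ y)
  cross  : ∀ {m} (x : Vec Bool (suc (suc m))) →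
           Adj (suc (suc (suc m))) (false ∷ x) (true ∷ twist x)
  cross' : ∀ {m} (x : Vec Bool (suc (suc m))) →
           Adj (suc (suc (suc m))) (true ∷ twist x) (false ∷ x)

-- λ(x,y): the smallest (1-based) index i with xᵢ ≠ yᵢ.
-- (Convention for x = y, never used for the statement: value n + 1.)
lam : ∀ {n} → Vec Bool n → Vec Bool n → ℕ
lam [] [] = 1
lam (a ∷ x) (b ∷ y) = if does (a ≟ b) then suc (lam x y) else 1

-- OnPath n v w u : w is a vertex of the path P_{u,v} = (u₀ = u, u₁, …, u_ℓ = v),
-- where u_{i+1} = τ_v(u_i) is the neighbour u' of u_i with λ(u_i,u') = λ(u_i,v),
-- the path stopping the first time v is reached.
data OnPath (n : ℕ) (v w : Vec Bool n) : Vec Bool n → Set where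
  here : OnPath n v w w
  step : ∀ {u u'} → u ≢ v → Adj n u u' → lam u u' ≡ lam u v →
         OnPath n v w u' → OnPath n v w u

InD : (n : ℕ) → Vec Bool n → ℕ → ℕ → Vec Bool n → Set
InD n v t₁ t₂ u = u ≢ v × t₁ ≤ lam u v × lam u v ≤ t₂

InF : (n : ℕ) → Vec Bool n → Vec Bool n → ℕ → ℕ → Vec Bool n → Set
InF n v w t₁ t₂ u = InD n v t₁ t₂ u × OnPath n v w u

module Submission where

-- In LTQ_n every vertex u has exactly one neighbour in each
-- dimension i; we give it explicitly as  nbr i u  (flip bit i, and for i = 1
-- also apply the cross-edge relabelling).  The map nbr i is an involution,
-- λ(u, nbr i u) = i, and every edge of LTQ_n has this form.  Hence the step
-- τ_v(u) is nbr (λ(u,v)) u, and λ(·,v) strictly increases along P_{u,v}; so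
-- every vertex of F(v,w;k,d) with d = λ(w,v) is w itself or has λ(u,v) < d.
--
-- Writing F_k for F(v,w;k,d), the top layer F_d is {w}, and for k < d
--   F_k = F_{k+1} ⊔ nbr k (F_{k+1}),
-- because a vertex u with λ(u,v) = k lies in F_k exactly when its first path
-- step nbr k u lies in F_{k+1}, and nbr k moves F_{k+1} onto the λ = k layer.
-- Since nbr k is injective, each step doubles a duplicate-free enumeration,
-- giving |F_k| = 2^(d-k) by induction on d - k.

open import Defs
open import Data.Bool using (Bool; true; false; not; _xor_)
open import Data.Bool.Properties using (_≟_; ¬-not; not-involutive; xor-assoc; xor-same; xor-identityʳ)
open import Data.Nat using (ℕ; zero; suc; _≤_; _<_; _^_; _∸_; _+_; _*_; z≤n; s≤s)
open import Data.Nat.Properties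
  using (module ≤-Reasoning; ≤-trans; ≤-refl; ≤-reflexive; <-irrefl; <-trans; <⇒≤; ≤-pred; m≤n⇒m<n∨m≡n; +-identityʳ; +-suc; m+[n∸m]≡n; m<m+n)
open import Data.Vec using (Vec; []; _∷_; last)
open import Data.List using (List; length; _++_; map) renaming ([] to nil; _∷_ to _::_)
open import Data.List.Properties using (length-++; length-map)
open import Data.List.Relation.Unary.Any using (here)
open import Data.List.Relation.Unary.All using () renaming ([] to all-nil)
open import Data.List.Relation.Unary.AllPairs using () renaming ([] to pairs-nil; _∷_ to _pairs∷_)
open import Data.List.Relation.Unary.Unique.Propositional using (Unique)
open import Data.List.Relation.Unary.Unique.Propositional.Properties using (++⁺; map⁺)
open import Data.List.Membership.Propositional using (_∈_; _∉_)
open import Data.List.Membership.Propositional.Properties using (∈-++⁻; ∈-++⁺ˡ; ∈-++⁺ʳ; ∈-map⁻; ∈-map⁺)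
open import Data.Product using (_×_; ∃; _,_; proj₁; proj₂)
open import Data.Sum using (_⊎_; inj₁; inj₂)
open import Data.Empty using (⊥; ⊥-elim)
open import Function using (_∘_)
open import Function.Bundles using (_⇔_; mk⇔; Equivalence)
open import Relation.Nullary using (yes; no; does)
open import Relation.Binary.PropositionalEquality
  using (_≡_; _≢_; refl; sym; trans; cong; cong₂; subst; module ≡-Reasoning)

-- The cross-edge relabelling of the suffix x₂⋯xₙ: twist on strings of length
-- ≥ 2, the identity on shorter ones (in LTQ₂ cross edges are plain Q₂ edges).
twist′ : ∀ {m} → Vec Bool m → Vec Bool m
twist′ [] = []
twist′ (b ∷ []) = b ∷ []
twist′ (b ∷ c ∷ xs) = twist (b ∷ c ∷ xs)

-- twist only changes x₂ by adding xₙ, which it leaves fixed; so it is an involution.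
twist′-involutive : ∀ {m} (x : Vec Bool m) → twist′ (twist′ x) ≡ x
twist′-involutive [] = refl
twist′-involutive (b ∷ []) = refl
twist′-involutive (b ∷ c ∷ xs) = cong (λ z → z ∷ c ∷ xs) xor-cancel
  where
  open ≡-Reasoning
  l : Bool
  l = last (c ∷ xs)
  xor-cancel : (b xor l) xor l ≡ b
  xor-cancel = begin
    (b xor l) xor l  ≡⟨ xor-assoc b l l ⟩
    b xor (l xor l)  ≡⟨ cong (b xor_) (xor-same l) ⟩
    b xor false      ≡⟨ xor-identityʳ b ⟩
    b                ∎

-- nbr i u : the neighbour of u in dimension i (1-based; nbr 0 is the identity).
-- It flips bit i, and for i = 1 also relabels the suffix as the cross edges do.
nbr : ∀ {n} → ℕ → Vec Bool n → Vec Bool n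
nbr zero x = x
nbr (suc i) [] = []
nbr (suc zero) (a ∷ x) = not a ∷ twist′ x
nbr (suc (suc i)) (a ∷ x) = a ∷ nbr (suc i) x

nbr-∷ : ∀ {n} {i} a (x : Vec Bool n) → 1 ≤ i → nbr (suc i) (a ∷ x) ≡ a ∷ nbr i x
nbr-∷ {i = suc i} a x _ = refl

nbr-involutive : ∀ {n} i (x : Vec Bool n) → nbr i (nbr i x) ≡ x
nbr-involutive zero x = refl
nbr-involutive (suc i) [] = refl
nbr-involutive (suc zero) (a ∷ x) = cong₂ _∷_ (not-involutive a) (twist′-involutive x)
nbr-involutive (suc (suc i)) (a ∷ x) = cong (a ∷_) (nbr-involutive (suc i) x)

nbr-injective : ∀ {n} i {x y : Vec Bool n} → nbr i x ≡ nbr i y → x ≡ y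
nbr-injective i {x} {y} e = trans (sym (nbr-involutive i x)) (trans (cong (nbr i) e) (nbr-involutive i y))

lam-pos : ∀ {n} (x y : Vec Bool n) → 1 ≤ lam x y
lam-pos [] [] = s≤s z≤n
lam-pos (a ∷ x) (b ∷ y) with does (a ≟ b)
... | true = s≤s z≤n
... | false = s≤s z≤n

lam-bound : ∀ {n} (u v : Vec Bool n) → u ≢ v → lam u v ≤ n
lam-bound [] [] u≢v = ⊥-elim (u≢v refl)
lam-bound (a ∷ x) (b ∷ y) u≢v with a ≟ b
... | yes refl = s≤s (lam-bound x y (u≢v ∘ cong (a ∷_)))
... | no _ = s≤s z≤n

lam-∷ : ∀ {n} a (x y : Vec Bool n) → lam (a ∷ x) (a ∷ y) ≡ suc (lam x y)
lam-∷ false x y = refl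
lam-∷ true x y = refl

lam-nbr : ∀ {n} i (u : Vec Bool n) → 1 ≤ i → i ≤ n → lam u (nbr i u) ≡ i
lam-nbr (suc zero) (false ∷ x) _ _ = refl
lam-nbr (suc zero) (true ∷ x) _ _ = refl
lam-nbr (suc (suc i)) (a ∷ x) _ (s≤s i<n) =
  trans (lam-∷ a x (nbr (suc i) x)) (cong suc (lam-nbr (suc i) x (s≤s z≤n) i<n))

lam-nbr-below : ∀ {n} i (x v : Vec Bool n) → 1 ≤ i → i < lam x v → lam (nbr i x) v ≡ i
lam-nbr-below (suc i) [] [] _ (s≤s ())
lam-nbr-below (suc zero) (a ∷ x) (b ∷ y) _ i<λ with a ≟ b
... | yes refl = lam-not-∷ a
  where
  lam-not-∷ : ∀ a → lam (not a ∷ twist′ x) (a ∷ y) ≡ 1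
  lam-not-∷ false = refl
  lam-not-∷ true = refl
... | no _ = ⊥-elim (<-irrefl refl i<λ)
lam-nbr-below (suc (suc i)) (a ∷ x) (b ∷ y) _ i<λ with a ≟ b
... | yes refl = cong suc (lam-nbr-below (suc i) x y (s≤s z≤n) (≤-pred i<λ))
lam-nbr-below (suc (suc i)) (a ∷ x) (b ∷ y) _ (s≤s ()) | no _

-- Flipping the first difference with v moves strictly closer to v: this is
-- what makes τ_v well defined as a step towards v.
lam-nbr-first : ∀ {n} (u v : Vec Bool n) → u ≢ v → lam u v < lam (nbr (lam u v) u) v
lam-nbr-first [] [] u≢v = ⊥-elim (u≢v refl)
lam-nbr-first (a ∷ x) (b ∷ y) u≢v with a ≟ b
... | yes refl = begin-strict
  suc (lam x y)                              <⟨ s≤s (lam-nbr-first x y (u≢v ∘ cong (a ∷_))) ⟩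
  suc (lam (nbr (lam x y) x) y)              ≡⟨ sym (lam-∷ a (nbr (lam x y) x) y) ⟩
  lam (a ∷ nbr (lam x y) x) (a ∷ y)          ≡⟨ cong (λ z → lam z (a ∷ y)) (sym (nbr-∷ a x (lam-pos x y))) ⟩
  lam (nbr (suc (lam x y)) (a ∷ x)) (a ∷ y)  ∎
  where open ≤-Reasoning
... | no a≢b rewrite ¬-not (a≢b ∘ sym) | lam-∷ (not a) (twist′ x) y = s≤s (lam-pos (twist′ x) y)

q₂-nbr : ∀ i (u : Vec Bool 2) → 1 ≤ i → i ≤ 2 → hamming u (nbr i u) ≡ 1
q₂-nbr (suc zero) (false ∷ false ∷ []) _ _ = refl
q₂-nbr (suc zero) (false ∷ true ∷ []) _ _ = refl
q₂-nbr (suc zero) (true ∷ false ∷ []) _ _ = refl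
q₂-nbr (suc zero) (true ∷ true ∷ []) _ _ = refl
q₂-nbr (suc (suc zero)) (false ∷ false ∷ []) _ _ = refl
q₂-nbr (suc (suc zero)) (false ∷ true ∷ []) _ _ = refl
q₂-nbr (suc (suc zero)) (true ∷ false ∷ []) _ _ = refl
q₂-nbr (suc (suc zero)) (true ∷ true ∷ []) _ _ = refl
q₂-nbr (suc (suc (suc i))) u _ (s≤s (s≤s ()))

adj-nbr : ∀ {m} i (u : Vec Bool (suc (suc m))) → 1 ≤ i → i ≤ suc (suc m) → Adj (suc (suc m)) u (nbr i u)
adj-nbr {zero} i u 1≤i i≤2 = base (q₂-nbr i u 1≤i i≤2)
adj-nbr {suc m} (suc zero) (false ∷ x@(_ ∷ _ ∷ _)) _ _ = cross x
adj-nbr {suc m} (suc zero) (true ∷ x@(_ ∷ _ ∷ _)) _ _ =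
  subst (λ y → Adj _ (true ∷ y) (false ∷ twist x)) (twist′-involutive x) (cross' (twist x))
adj-nbr {suc m} (suc (suc i)) (a ∷ x) _ (s≤s i<n) = inner a (adj-nbr (suc i) x (s≤s z≤n) i<n)

adjacent : ∀ {n} → 2 ≤ n → ∀ i (u : Vec Bool n) → 1 ≤ i → i ≤ n → Adj n u (nbr i u)
adjacent (s≤s (s≤s _)) = adj-nbr

q₂-unique : (u u' : Vec Bool 2) → hamming u u' ≡ 1 → u' ≡ nbr (lam u u') u
q₂-unique (false ∷ false ∷ []) (false ∷ false ∷ []) ()
q₂-unique (false ∷ false ∷ []) (false ∷ true ∷ []) _ = refl
q₂-unique (false ∷ false ∷ []) (true ∷ false ∷ []) _ = refl
q₂-unique (false ∷ false ∷ []) (true ∷ true ∷ []) ()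
q₂-unique (false ∷ true ∷ []) (false ∷ false ∷ []) _ = refl
q₂-unique (false ∷ true ∷ []) (false ∷ true ∷ []) ()
q₂-unique (false ∷ true ∷ []) (true ∷ false ∷ []) ()
q₂-unique (false ∷ true ∷ []) (true ∷ true ∷ []) _ = refl
q₂-unique (true ∷ false ∷ []) (false ∷ false ∷ []) _ = refl
q₂-unique (true ∷ false ∷ []) (false ∷ true ∷ []) ()
q₂-unique (true ∷ false ∷ []) (true ∷ false ∷ []) ()
q₂-unique (true ∷ false ∷ []) (true ∷ true ∷ []) _ = refl
q₂-unique (true ∷ true ∷ []) (false ∷ false ∷ []) ()
q₂-unique (true ∷ true ∷ []) (false ∷ true ∷ []) _ = refl
q₂-unique (true ∷ true ∷ []) (true ∷ false ∷ []) _ = refl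
q₂-unique (true ∷ true ∷ []) (true ∷ true ∷ []) ()

adj-unique : ∀ {n} {u u' : Vec Bool n} → Adj n u u' → u' ≡ nbr (lam u u') u
adj-unique (base {u} {u'} h) = q₂-unique u u' h
adj-unique (inner {x = x} {y} b adj) = begin
  b ∷ y                           ≡⟨ cong (b ∷_) (adj-unique adj) ⟩
  b ∷ nbr (lam x y) x             ≡⟨ sym (nbr-∷ b x (lam-pos x y)) ⟩
  nbr (suc (lam x y)) (b ∷ x)     ≡⟨ cong (λ i → nbr i (b ∷ x)) (sym (lam-∷ b x y)) ⟩
  nbr (lam (b ∷ x) (b ∷ y)) (b ∷ x) ∎
  where open ≡-Reasoning
adj-unique (cross (b ∷ c ∷ xs)) = refl
adj-unique (cross' x@(b ∷ c ∷ xs)) = cong (false ∷_) (sym (twist′-involutive x))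

τ-is-nbr : ∀ {n} {v u u' : Vec Bool n} → Adj n u u' → lam u u' ≡ lam u v → u' ≡ nbr (lam u v) u
τ-is-nbr {u = u} adj eq = trans (adj-unique adj) (cong (λ i → nbr i u) eq)

τ-rises : ∀ {n} {v u u' : Vec Bool n} → u ≢ v → Adj n u u' → lam u u' ≡ lam u v → lam u v < lam u' v
τ-rises {v = v} {u} u≢v adj eq =
  subst (λ z → lam u v < lam z v) (sym (τ-is-nbr adj eq)) (lam-nbr-first u v u≢v)

path-rises : ∀ {n} {v w u : Vec Bool n} → OnPath n v w u → u ≡ w ⊎ lam u v < lam w v
path-rises here = inj₁ refl
path-rises (step u≢v adj eq p) with path-rises p
... | inj₁ refl = inj₂ (τ-rises u≢v adj eq)
... | inj₂ lt = inj₂ (<-trans (τ-rises u≢v adj eq) lt)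

path-bound : ∀ {n} {v w u : Vec Bool n} → OnPath n v w u → lam u v ≤ lam w v
path-bound p with path-rises p
... | inj₁ refl = ≤-refl
... | inj₂ lt = <⇒≤ lt

-- A path starting at v is trivial (it stops at v at once), so it cannot pass
-- through any w ≠ v.
path-avoids-v : ∀ {n} {v w : Vec Bool n} → w ≢ v → OnPath n v w v → ⊥
path-avoids-v w≢v here = w≢v refl
path-avoids-v _ (step v≢v _ _ _) = v≢v refl

module _ {a} {A : Set a} {f : A → A} {P : List A} where

  doubled-unique : Unique P → (∀ {x y} → f x ≡ f y → x ≡ y) → (∀ {x} → x ∈ P → f x ∉ P) →
                   Unique (P ++ map f P)
  doubled-unique uniqP f-inj f-leaves = ++⁺ uniqP (map⁺ f-inj uniqP) disjoint
    where
    disjoint : ∀ {z} → z ∈ P × z ∈ map f P → ⊥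
    disjoint (zP , zfP) with ∈-map⁻ f zfP
    ... | x , xP , refl = f-leaves xP zP

  doubled-length : length (P ++ map f P) ≡ 2 * length P
  doubled-length = begin
    length (P ++ map f P)         ≡⟨ length-++ P ⟩
    length P + length (map f P)   ≡⟨ cong (length P +_) (length-map f P) ⟩
    length P + length P           ≡⟨ cong (length P +_) (sym (+-identityʳ (length P))) ⟩
    2 * length P                  ∎
    where open ≡-Reasoning

module Layers (n : ℕ) (2≤n : 2 ≤ n) (v w : Vec Bool n) (w≢v : w ≢ v) where

  d : ℕ
  d = lam w v

  F : ℕ → Vec Bool n → Set
  F k = InF n v w k d

  -- The top layer F d is {w}: every other vertex on a path to w has λ(·,v) < d.
  top-layer : ∀ {k} → k ≡ d → ∀ u → u ∈ w :: nil ⇔ F k u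
  top-layer refl u = mk⇔ to from
    where
    to : u ∈ w :: nil → F d u
    to (here refl) = (w≢v , ≤-refl , ≤-refl) , here
    from : F d u → u ∈ w :: nil
    from ((_ , d≤λ , _) , p) with path-rises p
    ... | inj₁ u≡w = here u≡w
    ... | inj₂ λ<d = ⊥-elim (<-irrefl refl (≤-trans λ<d d≤λ))

  -- nbr k maps F (k+1) into the λ = k part of F k: the new vertex has
  -- λ(·,v) = k and its first path step is the old vertex.
  lower : ∀ {k x} → 1 ≤ k → F (suc k) x → lam (nbr k x) v ≡ k × F k (nbr k x)
  lower {k} {x} 1≤k ((x≢v , k<λ , λ≤d) , p) =
    λ-new , (y≢v , ≤-reflexive (sym λ-new) , λ-new≤d) , step y≢v y~x λ-step p
    where
    y : Vec Bool n
    y = nbr k x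
    k≤n : k ≤ n
    k≤n = ≤-trans (<⇒≤ k<λ) (lam-bound x v x≢v)
    λ-new : lam y v ≡ k
    λ-new = lam-nbr-below k x v 1≤k k<λ
    λ-new≤d : lam y v ≤ d
    λ-new≤d = ≤-trans (≤-reflexive λ-new) (≤-trans (<⇒≤ k<λ) λ≤d)
    y≢v : y ≢ v
    y≢v y≡v = <-irrefl (trans (sym (lam-nbr k x 1≤k k≤n)) (cong (lam x) y≡v)) k<λ
    y~x : Adj n y x
    y~x = subst (Adj n y) (nbr-involutive k x) (adjacent 2≤n k y 1≤k k≤n)
    λ-step : lam y x ≡ lam y v
    λ-step = trans (trans (cong (lam y) (sym (nbr-involutive k x))) (lam-nbr k y 1≤k k≤n)) (sym λ-new)

  raise : ∀ {k u} → F k u → lam u v ≡ k → k < d → F (suc k) (nbr k u)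
  raise (_ , here) λ≡k k<d = ⊥-elim (<-irrefl (sym λ≡k) k<d)
  raise {k} {u} ((u≢v , _ , _) , step {u' = u'} _ u~u' eq p) λ≡k _ =
    subst (F (suc k)) u'≡ ((u'≢v , k<λ' , path-bound p) , p)
    where
    u'≡ : u' ≡ nbr k u
    u'≡ = trans (τ-is-nbr u~u' eq) (cong (λ i → nbr i u) λ≡k)
    u'≢v : u' ≢ v
    u'≢v u'≡v = path-avoids-v w≢v (subst (OnPath n v w) u'≡v p)
    k<λ' : k < lam u' v
    k<λ' = subst (_< lam u' v) λ≡k (τ-rises u≢v u~u' eq)

  layer-members : ∀ {k} {P : List (Vec Bool n)} → 1 ≤ k → k < d →
                  (∀ u → u ∈ P ⇔ F (suc k) u) → ∀ u → u ∈ P ++ map (nbr k) P ⇔ F k u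
  layer-members {k} {P} 1≤k k<d P-enum u = mk⇔ to from
    where
    to : u ∈ P ++ map (nbr k) P → F k u
    to u∈ with ∈-++⁻ P u∈
    ... | inj₁ uP = let ((u≢v , k<λ , λ≤d) , p) = Equivalence.to (P-enum u) uP in (u≢v , <⇒≤ k<λ , λ≤d) , p
    ... | inj₂ u∈map with ∈-map⁻ (nbr k) u∈map
    ...   | x , xP , refl = proj₂ (lower 1≤k (Equivalence.to (P-enum x) xP))
    from : F k u → u ∈ P ++ map (nbr k) P
    from Fu@((u≢v , k≤λ , λ≤d) , p) with m≤n⇒m<n∨m≡n k≤λ
    ... | inj₁ k<λ = ∈-++⁺ˡ (Equivalence.from (P-enum u) ((u≢v , k<λ , λ≤d) , p))
    ... | inj₂ k≡λ = ∈-++⁺ʳ P (subst (_∈ map (nbr k) P) (nbr-involutive k u) (∈-map⁺ (nbr k) raised∈P))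
      where
      raised∈P : nbr k u ∈ P
      raised∈P = Equivalence.from (P-enum (nbr k u)) (raise Fu (sym k≡λ) k<d)

  -- The two halves are disjoint: nbr k lands on λ = k, outside F (k+1).
  nbr-leaves : ∀ {k} {P : List (Vec Bool n)} → 1 ≤ k →
               (∀ u → u ∈ P ⇔ F (suc k) u) → ∀ {x} → x ∈ P → nbr k x ∉ P
  nbr-leaves {k} 1≤k P-enum {x} xP yP =
    <-irrefl (sym (proj₁ (lower 1≤k (Equivalence.to (P-enum x) xP))))
             (proj₁ (proj₂ (proj₁ (Equivalence.to (P-enum (nbr k x)) yP))))

  enumerate : ∀ m k → 1 ≤ k → k + m ≡ d →
              ∃ λ (L : List (Vec Bool n)) → Unique L × (∀ u → u ∈ L ⇔ F k u) × length L ≡ 2 ^ m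
  enumerate zero k _ k+0≡d =
    w :: nil , (all-nil pairs∷ pairs-nil) , top-layer (trans (sym (+-identityʳ k)) k+0≡d) , refl
  enumerate (suc m) k 1≤k k+m+1≡d with enumerate m (suc k) (s≤s z≤n) (trans (sym (+-suc k m)) k+m+1≡d)
  ... | P , uniqP , P-enum , |P| =
    P ++ map (nbr k) P ,
    doubled-unique uniqP (nbr-injective k) (nbr-leaves 1≤k P-enum) ,
    layer-members 1≤k k<d P-enum ,
    trans (doubled-length {f = nbr k} {P}) (cong (2 *_) |P|)
    where
    k<d : k < d
    k<d = subst (k <_) k+m+1≡d (m<m+n k (s≤s z≤n))

lemma3p1 : (n : ℕ) → 2 ≤ n → (v w : Vec Bool n) → w ≢ v →
           (k : ℕ) → 1 ≤ k → k ≤ lam w v →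
           ∃ λ (L : List (Vec Bool n)) →
             Unique L ×
             (∀ u → (u ∈ L) ⇔ InF n v w k (lam w v) u) ×
             length L ≡ 2 ^ (lam w v ∸ k)
lemma3p1 n 2≤n v w w≢v k 1≤k k≤d = enumerate (lam w v ∸ k) k 1≤k (m+[n∸m]≡n k≤d)
  where open Layers n 2≤n v w w≢v
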